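{- Let $n\geq 2$ and let $\mathcal{F}\subset\binom{[n]}{k}$ be an arbitrary family. Then $\beta(\mathcal{F})\leq \frac{k}{n-1}\gamma(\mathcal{F})$.
   Context: $\binom{[n]}{k}$ denotes the family of all $k$-element subsets of $[n]=\{1,\dots,n\}$. For distinct $i,j\in[n]$, let $b_{ij}(\mathcal{F})=|\{F\in\mathcal{F}\colon i\in F,\ j\notin F\}|$; the sturdiness is $\beta(\mathcal{F})=\min_{1\leq i\neq j\leq n} b_{ij}(\mathcal{F})$. The diversity is $\gamma(\mathcal{F})=\min_{y\in[n]}|\{F\in\mathcal{F}\colon y\notin F\}|$. -}

module Defs where

open import Data.Nat using (ℕ; zero; suc; _⊓_)
open import Data.Bool using (Bool; true; false; if_then_else_; _∧_; not)
open import Data.Fin using (Fin)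
open import Data.Fin.Properties using () renaming (_≟_ to _≟ᶠ_)
open import Data.Fin.Subset using (Subset; _∈_; _∉_; ∣_∣)
open import Data.Fin.Subset.Properties using (_∈?_)
open import Data.List using (List; []; _∷_; length; filter; concatMap; allFin; map)
open import Relation.Nullary using (¬_; Dec; yes; no)
open import Relation.Nullary.Decidable using (⌊_⌋; ¬?)
open import Data.List.Relation.Unary.All using (All)
open import Data.List.Relation.Unary.Unique.Propositional using (Unique)
open import Relation.Binary.PropositionalEquality using (_≡_)
open import Data.Product using (_×_; _,_; proj₁; proj₂)
open import Relation.Nullary.Decidable using (_×-dec_)

_⊆Binom_,_ : ∀ {n} → List (Subset n) → ℕ → ℕ → Set
𝓕 ⊆Binom n , k = Unique 𝓕 × All (λ F → ∣ F ∣ ≡ k) 𝓕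

-- minimum of a nonempty list (default 0 on the empty list; never used
-- for n ≥ 2 since the index sets below are then nonempty)
minList : List ℕ → ℕ
minList []       = 0
minList (x ∷ []) = x
minList (x ∷ y ∷ xs) = x ⊓ minList (y ∷ xs)

b : ∀ {n} → List (Subset n) → Fin n → Fin n → ℕ
b 𝓕 i j = length (filter (λ F → (i ∈? F) ×-dec ¬? (j ∈? F)) 𝓕)

distinctPairs : (n : ℕ) → List (Fin n × Fin n)
distinctPairs n =
  filter (λ p → ¬? (proj₁ p ≟ᶠ proj₂ p))
         (concatMap (λ i → map (λ j → (i , j)) (allFin n)) (allFin n))

β : ∀ {n} → List (Subset n) → ℕ
β {n} 𝓕 = minList (map (λ p → b 𝓕 (proj₁ p) (proj₂ p)) (distinctPairs n))

missing : ∀ {n} → List (Subset n) → Fin n → ℕ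
missing 𝓕 y = length (filter (λ F → ¬? (y ∈? F)) 𝓕)

γ : ∀ {n} → List (Subset n) → ℕ
γ {n} 𝓕 = minList (map (missing 𝓕) (allFin n))

-- Fix y attaining γ(𝓕) and double count the pairs (x, F) with x ∈ F ∌ y:
-- each of the γ(𝓕) members missing y contributes its k elements, so
-- ∑ₓ b_xy(𝓕) = k γ(𝓕), while each of the n − 1 terms with x ≠ y is at least β(𝓕).
module Submission where

open import Defs
open import Data.Nat using (ℕ; _≤_; _*_; _∸_)
open import Data.Fin.Subset using (Subset)
open import Data.List using (List)

open import Data.Nat using (zero; suc; _+_; z≤n)
open import Data.Nat.Properties
  using (+-*-semiring; ≤-refl; ≤-trans; +-mono-≤; m≤n+m; m⊓n≤m; m⊓n≤n; ⊓-sel;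
         *-zeroʳ; *-distribˡ-+; module ≤-Reasoning)
open import Algebra.Properties.Semiring.Sum +-*-semiring
  using (sum-syntax; sum-cong-≗; sum-replicate-zero; sum-remove; ∑-distrib-+; *-distribʳ-sum)
open import Data.Bool using (true; false; if_then_else_)
open import Data.Fin using (Fin; punchIn)
open import Data.Fin.Properties using (punchInᵢ≢i) renaming (_≟_ to _≟ᶠ_)
open import Data.Fin.Subset using (inside; outside; ∣_∣)
open import Data.Fin.Subset.Properties using (_∈?_)
open import Data.Vec using (_∷_; [])
open import Data.List using (_∷_; []; filter; length; map; allFin; tabulate)
open import Data.List.Membership.Propositional using (_∈_)
open import Data.List.Membership.Propositional.Properties
  using (∈-map⁺; ∈-concatMap⁺; ∈-filter⁺; ∈-allFin)
open import Data.List.Relation.Unary.Any using (here; there)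
import Data.List.Relation.Unary.Any as Any
open import Data.List.Relation.Unary.All using (All; []; _∷_)
open import Data.Product using (_,_; proj₁; proj₂; ∃)
open import Data.Sum using (inj₁; inj₂)
open import Function using (_∘_)
open import Relation.Nullary using (Dec; does; _because_)
open import Relation.Nullary.Decidable using (¬?; _×-dec_)
open import Relation.Binary.PropositionalEquality
  using (_≡_; _≢_; refl; sym; trans; cong; cong₂; module ≡-Reasoning)

indicator : ∀ {a} {A : Set a} → Dec A → ℕ
indicator A? = if does A? then 1 else 0

indicator-×-dec : ∀ {a b} {A : Set a} {B : Set b} (A? : Dec A) (B? : Dec B) →
  indicator (A? ×-dec B?) ≡ indicator A? * indicator B?
indicator-×-dec (true  because _) (true  because _) = refl
indicator-×-dec (true  because _) (false because _) = refl
indicator-×-dec (false because _) _                 = refl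

length-filter-∷ : ∀ {a p} {A : Set a} {P : A → Set p} (P? : ∀ x → Dec (P x)) x xs →
  length (filter P? (x ∷ xs)) ≡ indicator (P? x) + length (filter P? xs)
length-filter-∷ P? x xs with P? x
... | true  because _ = refl
... | false because _ = refl

-- The tails agree definitionally: `does (suc x ∈? s ∷ p)` computes to `does (x ∈? p)`.
∑-indicator-∈≡∣∣ : ∀ {n} (p : Subset n) → ∑[ x < n ] indicator (x ∈? p) ≡ ∣ p ∣
∑-indicator-∈≡∣∣ []            = refl
∑-indicator-∈≡∣∣ (inside  ∷ p) = cong suc (∑-indicator-∈≡∣∣ p)
∑-indicator-∈≡∣∣ (outside ∷ p) = ∑-indicator-∈≡∣∣ p

∑-lower-bound : ∀ {n} c (f : Fin n → ℕ) → (∀ x → c ≤ f x) → n * c ≤ ∑[ x < n ] f x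
∑-lower-bound {zero}  c f c≤f = z≤n
∑-lower-bound {suc n} c f c≤f = +-mono-≤ (c≤f _) (∑-lower-bound c (f ∘ Fin.suc) (c≤f ∘ Fin.suc))

∑-lower-bound-except : ∀ {n} c (f : Fin (suc n) → ℕ) y → (∀ x → x ≢ y → c ≤ f x) →
  n * c ≤ ∑[ x < suc n ] f x
∑-lower-bound-except {n} c f y c≤f = begin
  n * c                              ≤⟨ ∑-lower-bound c (f ∘ punchIn y) (λ x → c≤f _ (punchInᵢ≢i y x)) ⟩
  ∑[ x < n ] f (punchIn y x)         ≤⟨ m≤n+m _ (f y) ⟩
  f y + (∑[ x < n ] f (punchIn y x)) ≡⟨ sum-remove f ⟨
  ∑[ x < suc n ] f x                 ∎
  where open ≤-Reasoning

∑-b≡k*missing : ∀ {n} k (𝓕 : List (Subset n)) y → All (λ F → ∣ F ∣ ≡ k) 𝓕 →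
  ∑[ x < n ] b 𝓕 x y ≡ k * missing 𝓕 y
∑-b≡k*missing {n} k [] y [] = trans (sum-replicate-zero n) (sym (*-zeroʳ k))
∑-b≡k*missing {n} k (F ∷ 𝓕) y (∣F∣≡k ∷ sizes≡k) = begin
  ∑[ x < n ] b (F ∷ 𝓕) x y
    ≡⟨ sum-cong-≗ b-∷ ⟩
  ∑[ x < n ] (indicator (x ∈? F) * c + b 𝓕 x y)
    ≡⟨ ∑-distrib-+ (λ x → indicator (x ∈? F) * c) (λ x → b 𝓕 x y) ⟩
  ∑[ x < n ] (indicator (x ∈? F) * c) + ∑[ x < n ] b 𝓕 x y
    ≡⟨ cong₂ _+_ (sym (*-distribʳ-sum c (λ x → indicator (x ∈? F)))) (∑-b≡k*missing k 𝓕 y sizes≡k) ⟩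
  (∑[ x < n ] indicator (x ∈? F)) * c + k * missing 𝓕 y
    ≡⟨ cong (λ s → s * c + k * missing 𝓕 y) (trans (∑-indicator-∈≡∣∣ F) ∣F∣≡k) ⟩
  k * c + k * missing 𝓕 y
    ≡⟨ *-distribˡ-+ k c _ ⟨
  k * (c + missing 𝓕 y)
    ≡⟨ cong (k *_) (length-filter-∷ _ F 𝓕) ⟨
  k * missing (F ∷ 𝓕) y
    ∎
  where
  open ≡-Reasoning
  c = indicator (¬? (y ∈? F))
  b-∷ : ∀ x → b (F ∷ 𝓕) x y ≡ indicator (x ∈? F) * c + b 𝓕 x y
  b-∷ x = trans (length-filter-∷ _ F 𝓕) (cong (_+ b 𝓕 x y) (indicator-×-dec (x ∈? F) (¬? (y ∈? F))))

minList-≤ : ∀ {z} xs → z ∈ xs → minList xs ≤ z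
minList-≤ (x ∷ [])     (here refl) = ≤-refl
minList-≤ (x ∷ y ∷ xs) (here refl) = m⊓n≤m x _
minList-≤ (x ∷ y ∷ xs) (there z∈)  = ≤-trans (m⊓n≤n x _) (minList-≤ (y ∷ xs) z∈)

minList-map-attained : ∀ {A : Set} (f : A → ℕ) x xs → ∃ λ y → minList (map f (x ∷ xs)) ≡ f y
minList-map-attained f x []        = x , refl
minList-map-attained f x (x′ ∷ xs) with minList-map-attained f x′ xs
... | y , min≡fy with ⊓-sel (f x) (minList (map f (x′ ∷ xs)))
...   | inj₁ min≡fx  = x , min≡fx
...   | inj₂ min≡min = y , trans min≡min min≡fy

∈-distinctPairs : ∀ {n} {x y : Fin n} → x ≢ y → (x , y) ∈ distinctPairs n
∈-distinctPairs {n} {x} {y} x≢y =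
  ∈-filter⁺ (λ p → ¬? (proj₁ p ≟ᶠ proj₂ p))
    (∈-concatMap⁺ (λ i → map (i ,_) (allFin n))
      (Any.map (λ { refl → ∈-map⁺ (x ,_) (∈-allFin y) }) (∈-allFin x)))
    x≢y

β≤b : ∀ {n} (𝓕 : List (Subset n)) {x y} → x ≢ y → β 𝓕 ≤ b 𝓕 x y
β≤b 𝓕 x≢y = minList-≤ _ (∈-map⁺ (λ p → b 𝓕 (proj₁ p) (proj₂ p)) (∈-distinctPairs x≢y))

γ-attained : ∀ {n} (𝓕 : List (Subset (suc n))) → ∃ λ y → γ 𝓕 ≡ missing 𝓕 y
γ-attained 𝓕 = minList-map-attained (missing 𝓕) _ (tabulate Fin.suc)

proposition3p1 : (n k : ℕ) → 2 ≤ n → (𝓕 : List (Subset n)) → 𝓕 ⊆Binom n , k →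
    (n ∸ 1) * β 𝓕 ≤ k * γ 𝓕
proposition3p1 (suc n) k _ 𝓕 (_ , sizes≡k) with γ-attained 𝓕
... | y , γ≡missing = begin
  n * β 𝓕                ≤⟨ ∑-lower-bound-except (β 𝓕) (λ x → b 𝓕 x y) y (λ _ → β≤b 𝓕) ⟩
  ∑[ x < suc n ] b 𝓕 x y ≡⟨ ∑-b≡k*missing k 𝓕 y sizes≡k ⟩
  k * missing 𝓕 y        ≡⟨ cong (k *_) γ≡missing ⟨
  k * γ 𝓕                ∎
  where open ≤-Reasoning
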